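{- For every $n\in\mathbb N$, the map $\varphi_2:SC_{7,n}\to SC_{7,4n+6}$ given by $$\varphi_2(-z,-y,-x,0,x,y,z)=(2y+1,\,-2x,\,2z+1,\,0,\,-2z-1,\,2x,\,-2y-1)$$ is a bijection.
   Context: $\mathbb N=\{0,1,2,\ldots\}$. A partition $\lambda$ is determined by its arm set $A^+(\lambda)=\{\lambda_i-i:1\le i\le s\}$ and leg set $L^+(\lambda)=\{\lambda^*_i-i:1\le i\le s\}$ ($s=\#\{i:\lambda_i\ge i\}$, $\lambda^*$ the conjugate); any two finite subsets of $\mathbb N$ of equal size are the leg and arm sets of a unique partition. For $c=(c_0,\ldots,c_{t-1})\in\mathbb Z^t$ with coordinate sum $0$, $\lambda_c$ is the partition with arm set $\{qt+j:0\le q<c_j\}$ and leg set $\{qt+t-j-1:0\le q<-c_j\}$. $SC_{t,n}$ is the set of such $c$ with $|\lambda_c|=n$ and $\lambda_c^*=\lambda_c$; elements of $SC_{7,n}$ have the form $(-z,-y,-x,0,x,y,z)$ with $x,y,z\in\mathbb Z$. -}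

module Defs where

open import Data.Nat using (ℕ; zero; suc; _+_; _*_; _∸_)
open import Data.Integer as ℤ using (ℤ; +_; -[1+_])
open import Data.Fin using (Fin; toℕ)
open import Data.Vec using (Vec; lookup; _∷_; [])
open import Data.List using (List; map; concatMap; upTo; allFin; length)
open import Data.Nat.ListAction using (sum)
open import Data.List.Membership.Propositional using (_∈_)
open import Data.Product using (_×_)
open import Relation.Binary.PropositionalEquality using (_≡_)

pos : ℤ → ℕ
pos (+ n) = n
pos -[1+ n ] = 0

neg : ℤ → ℕ
neg (+ n) = 0
neg -[1+ n ] = suc n

sumℤ : ∀ {t} → Vec ℤ t → ℤ
sumℤ [] = + 0
sumℤ (x ∷ xs) = x ℤ.+ sumℤ xs

-- A partition represented by its (arm set, leg set) = (A⁺(λ), L⁺(λ)),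
-- each a duplicate-free list of naturals (as in the context, this pair
-- determines the partition uniquely).
record Frob : Set where
  constructor frob
  field
    arms : List ℕ
    legs : List ℕ
open Frob public

-- size |λ| = Σ_i (a_i + l_i + 1) = Σ arms + Σ legs + s
size : Frob → ℕ
size λ' = sum (arms λ') + sum (legs λ') + length (arms λ')

-- conjugation swaps arm set and leg set (A⁺(λ*) = L⁺(λ))
conj : Frob → Frob
conj (frob a l) = frob l a

-- equality of partitions = equality of arm sets and of leg sets (as sets)
SameSet : List ℕ → List ℕ → Set
SameSet a b = ∀ k → (k ∈ a → k ∈ b) × (k ∈ b → k ∈ a)

SamePartition : Frob → Frob → Set
SamePartition λ₁ λ₂ = SameSet (arms λ₁) (arms λ₂) × SameSet (legs λ₁) (legs λ₂)

lam : ∀ t → Vec ℤ t → Frob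
lam t c = frob
  (concatMap (λ j → map (λ q → q * t + toℕ j) (upTo (pos (lookup c j)))) (allFin t))
  (concatMap (λ j → map (λ q → q * t + (t ∸ suc (toℕ j))) (upTo (neg (lookup c j)))) (allFin t))

SC : ∀ t → ℕ → Vec ℤ t → Set
SC t n c = (sumℤ c ≡ + 0) × (size (lam t c) ≡ n) × SamePartition (conj (lam t c)) (lam t c)

φ₂ : Vec ℤ 7 → Vec ℤ 7
φ₂ (_ ∷ _ ∷ _ ∷ _ ∷ x ∷ y ∷ z ∷ []) =
  (+ 2 ℤ.* y ℤ.+ + 1) ∷ ℤ.- (+ 2 ℤ.* x) ∷ (+ 2 ℤ.* z ℤ.+ + 1) ∷ + 0 ∷
  ℤ.- (+ 2 ℤ.* z ℤ.+ + 1) ∷ (+ 2 ℤ.* x) ∷ ℤ.- (+ 2 ℤ.* y ℤ.+ + 1) ∷ []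

-- The arm set of λ_c is the union over j of the residue classes j mod t
-- holding c_j elements, and its leg set the union of the residue classes
-- t−1−j mod t holding −c_j elements. So λ_c is self-conjugate exactly when
-- c_{t−1−j} = −c_j, which for t = 7 forces c = (−z,−y,−x,0,x,y,z).
-- Summing the arithmetic progressions column by column, the paired columns j
-- and 6−j contribute an integral quadratic, and
-- |λ_c| = (7x²+2x) + (7y²+4y) + (7z²+6z). Substituting φ₂ turns this form into
-- 4|λ_c| + 6, which gives the map and (as w ↦ 2w and w ↦ −(2w+1) are injective)
-- its injectivity. Conversely, reducing the form mod 4 according to the
-- parities of x, y, z shows that a value ≡ 2 mod 4 is attained only for x and
-- z odd and y even, that is, only on the image of φ₂.

module Submission where

open import Defs
open import Data.Nat using (ℕ; zero; suc)
open import Data.Integer using (ℤ; +_; -[1+_]; -_)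
open import Data.Fin using (Fin; toℕ; opposite)
open import Data.Fin.Properties using (toℕ<n; toℕ-injective; opposite-prop; opposite-involutive)
open import Data.Vec using (Vec; lookup)
open import Data.List using (List; []; _∷_; [_]; _++_; map; concatMap; upTo; allFin; length)
open import Data.List.Membership.Propositional using (_∈_; find; lose)
open import Data.Product using (_×_; _,_; ∃-syntax; proj₁; proj₂; swap)
open import Function using (case_of_; _∘_; id; _⇔_; mk⇔; Equivalence)
open Equivalence using (to; from)
open import Function.Definitions using (Injective)
open import Relation.Binary.PropositionalEquality using (_≡_; refl; sym; trans; cong; cong₂; subst; module ≡-Reasoning)

neg-negate : ∀ a → neg (- a) ≡ pos a
neg-negate (+ zero) = refl
neg-negate (+ suc n) = refl
neg-negate -[1+ n ] = refl

pos≡neg⇒≡- : ∀ {a b} → pos a ≡ neg b → pos b ≡ neg a → b ≡ - a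
pos≡neg⇒≡- {+ m} {+ n} refl refl = refl
pos≡neg⇒≡- {+ m} { -[1+ n ]} refl _ = refl
pos≡neg⇒≡- { -[1+ m ]} {+ n} _ refl = refl
pos≡neg⇒≡- { -[1+ m ]} { -[1+ n ]} () _

Skew : ∀ {t} → Vec ℤ t → Set
Skew c = ∀ j → lookup c (opposite j) ≡ - lookup c j

module CoreVectors where

  open import Data.Nat using (_+_; _*_; _∸_; _<_; _%_)
  open import Data.Nat.Properties
    using (+-comm; +-identityʳ; +-commutativeSemigroup; +-cancelʳ-≡; *-cancelʳ-≡; ≤-antisym; ≮⇒≥; <-irrefl)
  open import Data.Nat.DivMod using ([m+kn]%n≡m%n; m<n⇒m%n≡m)
  open import Data.List.Membership.Propositional.Properties
    using (∈-concatMap⁺; ∈-concatMap⁻; ∈-map⁺; ∈-map⁻; ∈-allFin; ∈-upTo⁺; ∈-upTo⁻)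
  open import Data.List.Properties
    using (map-cong; concatMap-cong; map-++; length-++; length-map; length-upTo; upTo-∷ʳ)
  open import Data.Nat.ListAction using (sum)
  open import Data.Nat.ListAction.Properties using (sum-++)
  open import Algebra.Properties.CommutativeSemigroup +-commutativeSemigroup using (interchange)

  *+toℕ-injective : ∀ {t} q q′ (i i′ : Fin t) → q * t + toℕ i ≡ q′ * t + toℕ i′ → q ≡ q′ × i ≡ i′
  *+toℕ-injective {suc n} q q′ i i′ eq = *-cancelʳ-≡ q q′ (suc n) (+-cancelʳ-≡ _ _ _ eq′) , i≡i′
    where
    remainder : ∀ q (i : Fin (suc n)) → (q * suc n + toℕ i) % suc n ≡ toℕ i
    remainder q i = begin
      (q * suc n + toℕ i) % suc n ≡⟨ cong (_% suc n) (+-comm (q * suc n) (toℕ i)) ⟩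
      (toℕ i + q * suc n) % suc n ≡⟨ [m+kn]%n≡m%n (toℕ i) q (suc n) ⟩
      toℕ i % suc n               ≡⟨ m<n⇒m%n≡m (toℕ<n i) ⟩
      toℕ i                       ∎
      where open ≡-Reasoning
    i≡i′ : i ≡ i′
    i≡i′ = toℕ-injective (trans (sym (remainder q i)) (trans (cong (_% suc n) eq) (remainder q′ i′)))
    eq′ : q * suc n + toℕ i′ ≡ q′ * suc n + toℕ i′
    eq′ = subst (λ k → q * suc n + toℕ k ≡ _) i≡i′ eq

  column : ∀ t → (Fin t → Fin t) → (Fin t → ℕ) → Fin t → List ℕ
  column t ρ m j = map (λ q → q * t + toℕ (ρ j)) (upTo (m j))

  columns : ∀ t → (Fin t → Fin t) → (Fin t → ℕ) → List ℕ
  columns t ρ m = concatMap (column t ρ m) (allFin t)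

  ∈-columns⁺ : ∀ {t} ρ m (j : Fin t) {q} → q < m j → q * t + toℕ (ρ j) ∈ columns t ρ m
  ∈-columns⁺ {t} ρ m j q<m = ∈-concatMap⁺ (column t ρ m) (lose (∈-allFin j) (∈-map⁺ _ (∈-upTo⁺ q<m)))

  ∈-columns⁻ : ∀ {t} ρ m {k} → k ∈ columns t ρ m →
    ∃[ j ] ∃[ q ] q < m j × k ≡ q * t + toℕ (ρ j)
  ∈-columns⁻ {t} ρ m k∈
    with j , _ , k∈column ← find (∈-concatMap⁻ (column t ρ m) {xs = allFin t} k∈)
    with q , q∈ , k≡ ← ∈-map⁻ (λ q → q * t + toℕ (ρ j)) k∈column
    = j , q , ∈-upTo⁻ q∈ , k≡

  ∈-columns⇒< : ∀ {t} ρ m → Injective _≡_ _≡_ ρ → ∀ (j : Fin t) {q} →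
    q * t + toℕ (ρ j) ∈ columns t ρ m → q < m j
  ∈-columns⇒< ρ m ρ-injective j {q} k∈
    with j′ , q′ , q′<m , eq ← ∈-columns⁻ ρ m k∈
    with refl , ρj≡ρj′ ← *+toℕ-injective q q′ (ρ j) (ρ j′) eq
    with refl ← ρ-injective ρj≡ρj′
    = q′<m

  legs≡columns : ∀ t (c : Vec ℤ t) → legs (lam t c) ≡ columns t opposite (neg ∘ lookup c)
  legs≡columns t c = concatMap-cong
    (λ j → map-cong (λ q → cong (λ r → q * t + r) (sym (opposite-prop j))) _) (allFin t)

  opposite-injective : ∀ {t} → Injective _≡_ _≡_ (opposite {t})
  opposite-injective {_} {i} {j} eq = begin
    i                     ≡⟨ opposite-involutive i ⟨
    opposite (opposite i) ≡⟨ cong opposite eq ⟩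
    opposite (opposite j) ≡⟨ opposite-involutive j ⟩
    j                     ∎
    where open ≡-Reasoning

  ∈-arms⇔ : ∀ {t} (c : Vec ℤ t) j {q} → q * t + toℕ j ∈ arms (lam t c) ⇔ q < pos (lookup c j)
  ∈-arms⇔ c j = mk⇔ (∈-columns⇒< id _ id j) (∈-columns⁺ id _ j)

  ∈-legs⇔ : ∀ {t} (c : Vec ℤ t) j {q} →
    q * t + toℕ j ∈ legs (lam t c) ⇔ q < neg (lookup c (opposite j))
  ∈-legs⇔ {t} c j {q} rewrite legs≡columns t c =
    subst (λ i → q * t + toℕ i ∈ columns t opposite (neg ∘ lookup c) ⇔ q < neg (lookup c (opposite j)))
      (opposite-involutive j)
      (mk⇔ (∈-columns⇒< opposite _ opposite-injective (opposite j))
           (∈-columns⁺ opposite _ (opposite j)))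

  same-lowerSet⇒≡ : ∀ {m n} → (∀ {q} → q < m → q < n) → (∀ {q} → q < n → q < m) → m ≡ n
  same-lowerSet⇒≡ m⊆n n⊆m =
    ≤-antisym (≮⇒≥ (λ n<m → <-irrefl refl (m⊆n n<m))) (≮⇒≥ (λ m<n → <-irrefl refl (n⊆m m<n)))

  arms≈legs⇔ : ∀ {t} (c : Vec ℤ t) →
    SameSet (arms (lam t c)) (legs (lam t c)) ⇔ (∀ j → pos (lookup c j) ≡ neg (lookup c (opposite j)))
  arms≈legs⇔ {t} c = mk⇔ sizes-match columns-match
    where
    sizes-match : SameSet (arms (lam t c)) (legs (lam t c)) → ∀ j → pos (lookup c j) ≡ neg (lookup c (opposite j))
    sizes-match arms≈legs j = same-lowerSet⇒≡
      (λ q<pos → to (∈-legs⇔ c j) (proj₁ (arms≈legs _) (from (∈-arms⇔ c j) q<pos)))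
      (λ q<neg → to (∈-arms⇔ c j) (proj₂ (arms≈legs _) (from (∈-legs⇔ c j) q<neg)))
    columns-match : (∀ j → pos (lookup c j) ≡ neg (lookup c (opposite j))) → SameSet (arms (lam t c)) (legs (lam t c))
    columns-match match k = arms⊆legs , legs⊆arms
      where
      arms⊆legs : k ∈ arms (lam t c) → k ∈ legs (lam t c)
      arms⊆legs k∈ with j , q , q<pos , refl ← ∈-columns⁻ id (pos ∘ lookup c) k∈ =
        from (∈-legs⇔ c j) (subst (q <_) (match j) q<pos)
      legs⊆arms : k ∈ legs (lam t c) → k ∈ arms (lam t c)
      legs⊆arms k∈
        with j , q , q<neg , refl ← ∈-columns⁻ opposite (neg ∘ lookup c) (subst (k ∈_) (legs≡columns t c) k∈) =
        from (∈-arms⇔ c (opposite j))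
          (subst (q <_) (sym (trans (match (opposite j)) (cong (neg ∘ lookup c) (opposite-involutive j)))) q<neg)

  arithSum : ℕ → ℕ → ℕ → ℕ
  arithSum t r m = sum (map (λ q → q * t + r) (upTo m))

  arithSum-suc : ∀ t r m → arithSum t r (suc m) ≡ arithSum t r m + (m * t + r)
  arithSum-suc t r m = begin
    sum (map f (upTo (suc m)))       ≡⟨ cong (sum ∘ map f) (upTo-∷ʳ m) ⟨
    sum (map f (upTo m ++ [ m ]))    ≡⟨ cong sum (map-++ f (upTo m) [ m ]) ⟩
    sum (map f (upTo m) ++ [ f m ])  ≡⟨ sum-++ (map f (upTo m)) [ f m ] ⟩
    arithSum t r m + (f m + 0)       ≡⟨ cong (λ x → arithSum t r m + x) (+-identityʳ (f m)) ⟩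
    arithSum t r m + f m             ∎
    where
    open ≡-Reasoning
    f : ℕ → ℕ
    f q = q * t + r

  sum-concatMap : ∀ {A : Set} (f : A → List ℕ) xs → sum (concatMap f xs) ≡ sum (map (sum ∘ f) xs)
  sum-concatMap f [] = refl
  sum-concatMap f (x ∷ xs) = trans (sum-++ (f x) _) (cong (λ n → sum (f x) + n) (sum-concatMap f xs))

  length-concatMap : ∀ {A B : Set} (f : A → List B) xs → length (concatMap f xs) ≡ sum (map (length ∘ f) xs)
  length-concatMap f [] = refl
  length-concatMap f (x ∷ xs) = trans (length-++ (f x)) (cong (λ n → length (f x) + n) (length-concatMap f xs))

  sum-map-+ : ∀ {A : Set} (f g : A → ℕ) xs → sum (map (λ x → f x + g x) xs) ≡ sum (map f xs) + sum (map g xs)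
  sum-map-+ f g [] = refl
  sum-map-+ f g (x ∷ xs) =
    trans (cong (λ n → f x + g x + n) (sum-map-+ f g xs)) (interchange (f x) (g x) (sum (map f xs)) (sum (map g xs)))

  columnSize : ℕ → ℕ → ℕ → ℤ → ℕ
  columnSize t r s a = arithSum t r (pos a) + arithSum t s (neg a) + pos a

  size-lam : ∀ t (c : Vec ℤ t) →
    size (lam t c) ≡ sum (map (λ j → columnSize t (toℕ j) (t ∸ suc (toℕ j)) (lookup c j)) (allFin t))
  size-lam t c = begin
    sum (concatMap armColumn js) + sum (concatMap legColumn js) + length (concatMap armColumn js)
      ≡⟨ cong₂ _+_ (cong₂ _+_ (sum-concatMap armColumn js) (sum-concatMap legColumn js))
                   (trans (length-concatMap armColumn js) (cong sum (map-cong armCount js))) ⟩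
    sum (map armSum js) + sum (map legSum js) + sum (map (pos ∘ lookup c) js)
      ≡⟨ cong (_+ sum (map (pos ∘ lookup c) js)) (sum-map-+ armSum legSum js) ⟨
    sum (map (λ j → armSum j + legSum j) js) + sum (map (pos ∘ lookup c) js)
      ≡⟨ sum-map-+ (λ j → armSum j + legSum j) (pos ∘ lookup c) js ⟨
    sum (map (λ j → armSum j + legSum j + pos (lookup c j)) js) ∎
    where
    open ≡-Reasoning
    js = allFin t
    armColumn legColumn : Fin t → List ℕ
    armColumn j = map (λ q → q * t + toℕ j) (upTo (pos (lookup c j)))
    legColumn j = map (λ q → q * t + (t ∸ suc (toℕ j))) (upTo (neg (lookup c j)))
    armSum legSum : Fin t → ℕ
    armSum j = arithSum t (toℕ j) (pos (lookup c j))
    legSum j = arithSum t (t ∸ suc (toℕ j)) (neg (lookup c j))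
    armCount : ∀ j → length (armColumn j) ≡ pos (lookup c j)
    armCount j = trans (length-map _ (upTo (pos (lookup c j)))) (length-upTo _)

open CoreVectors

armsMatchLegs⇔Skew : ∀ {t} (c : Vec ℤ t) → (∀ j → pos (lookup c j) ≡ neg (lookup c (opposite j))) ⇔ Skew c
armsMatchLegs⇔Skew c = mk⇔
  (λ match j → pos≡neg⇒≡- (match j) (trans (match (opposite j)) (cong (neg ∘ lookup c) (opposite-involutive j))))
  (λ skew j → sym (trans (cong neg (skew j)) (neg-negate (lookup c j))))

selfConjugate⇔Skew : ∀ {t} (c : Vec ℤ t) → SamePartition (conj (lam t c)) (lam t c) ⇔ Skew c
selfConjugate⇔Skew c = mk⇔
  (λ (_ , arms≈legs) → to (armsMatchLegs⇔Skew c) (to (arms≈legs⇔ c) arms≈legs))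
  (λ skew → let arms≈legs = from (arms≈legs⇔ c) (from (armsMatchLegs⇔Skew c) skew)
             in (λ k → swap (arms≈legs k)) , arms≈legs)

module SevenCores where

  open import Algebra using (AbelianGroup)
  open import Data.Integer using (_+_; _*_; _-_)
  open import Data.Integer.Properties
    using (+-injective; pos-+; pos-*; neg-involutive; neg-injective; *-cancelˡ-≡; *-distribˡ-+; +-0-abelianGroup)
  open import Algebra.Properties.Group (AbelianGroup.group +-0-abelianGroup) using (∙-cancelʳ)
  open import Data.Integer.DivMod using (_%ℕ_; _/ℕ_; n%ℕd<d; a≡a%ℕn+[a/ℕn]*n)
  open import Data.Integer.Divisibility using (_∣_)
  open import Data.Integer.Divisibility.Signed using (divides; ∣⇒∣ᵤ)
  open import Data.Nat.Divisibility using (n∣m⇒m%n≡0)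
  open import Data.Integer.Tactic.RingSolver using (solve-∀)
  import Data.Nat.Tactic.RingSolver as NatSolver
  import Data.Nat as ℕ
  open import Data.Fin using (#_; zero; suc)
  open import Data.Vec using (_∷_; [])
  open ≡-Reasoning

  pos-arithSum-suc : ∀ t r m → + arithSum t r (suc m) ≡ + arithSum t r m + (+ m * + t + + r)
  pos-arithSum-suc t r m = begin
    + arithSum t r (suc m)                          ≡⟨ cong +_ (arithSum-suc t r m) ⟩
    + (arithSum t r m ℕ.+ (m ℕ.* t ℕ.+ r))          ≡⟨ pos-+ (arithSum t r m) _ ⟩
    + arithSum t r m + + (m ℕ.* t ℕ.+ r)            ≡⟨ cong (λ v → + arithSum t r m + v) (pos-+ (m ℕ.* t) r) ⟩
    + arithSum t r m + (+ (m ℕ.* t) + + r)          ≡⟨ cong (λ v → + arithSum t r m + (v + + r)) (pos-* m t) ⟩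
    + arithSum t r m + (+ m * + t + + r)            ∎

  twice-arithSum : ∀ t r m → + 2 * + arithSum t r m ≡ + t * + m * + m + (+ 2 * + r - + t) * + m
  twice-arithSum t r zero = base (+ t) (+ r)
    where
    base : ∀ T R → + 2 * + 0 ≡ T * + 0 * + 0 + (+ 2 * R - T) * + 0
    base = solve-∀
  twice-arithSum t r (suc m) = begin
    + 2 * + arithSum t r (suc m)
      ≡⟨ cong (λ v → + 2 * v) (pos-arithSum-suc t r m) ⟩
    + 2 * (+ arithSum t r m + (+ m * + t + + r))
      ≡⟨ *-distribˡ-+ (+ 2) (+ arithSum t r m) _ ⟩
    + 2 * + arithSum t r m + + 2 * (+ m * + t + + r)
      ≡⟨ cong (λ v → v + + 2 * (+ m * + t + + r)) (twice-arithSum t r m) ⟩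
    + t * + m * + m + (+ 2 * + r - + t) * + m + + 2 * (+ m * + t + + r)
      ≡⟨ expand (+ t) (+ r) (+ m) ⟩
    + t * + suc m * + suc m + (+ 2 * + r - + t) * + suc m ∎
    where
    expand : ∀ T R M → T * M * M + (+ 2 * R - T) * M + + 2 * (M * T + R)
                       ≡ T * (+ 1 + M) * (+ 1 + M) + (+ 2 * R - T) * (+ 1 + M)
    expand = solve-∀

  column-half : ∀ t r m → + (2 ℕ.* arithSum t r m ℕ.+ m) ≡ + t * + m * + m + (+ 2 * + r + + 1 - + t) * + m
  column-half t r m = begin
    + (2 ℕ.* arithSum t r m ℕ.+ m)                      ≡⟨ pos-+ (2 ℕ.* arithSum t r m) m ⟩
    + (2 ℕ.* arithSum t r m) + + m                      ≡⟨ cong (λ v → v + + m) (trans (pos-* 2 (arithSum t r m)) (twice-arithSum t r m)) ⟩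
    + t * + m * + m + (+ 2 * + r - + t) * + m + + m     ≡⟨ regroup (+ t) (+ r) (+ m) ⟩
    + t * + m * + m + (+ 2 * + r + + 1 - + t) * + m     ∎
    where
    regroup : ∀ T R M → T * M * M + (+ 2 * R - T) * M + M ≡ T * M * M + (+ 2 * R + + 1 - T) * M
    regroup = solve-∀

  module _ (r s : ℕ) where

    private
      t = r ℕ.+ s ℕ.+ 1
      T = + r + + s + + 1

      column-half′ : ∀ q m → + (2 ℕ.* arithSum t q m ℕ.+ m) ≡ T * + m * + m + (+ 2 * + q + + 1 - T) * + m
      column-half′ q m = trans (column-half t q m) (cong (λ T → T * + m * + m + (+ 2 * + q + + 1 - T) * + m) pos-t)
        where
        pos-t : + t ≡ T
        pos-t = trans (pos-+ (r ℕ.+ s) 1) (cong (λ v → v + + 1) (pos-+ r s))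

    pair-size : ∀ w → + (columnSize t r s (- w) ℕ.+ columnSize t s r w) ≡ T * w * w + (+ s - + r) * w
    pair-size (+ zero) = vanish T (+ s - + r)
      where
      vanish : ∀ T D → + 0 ≡ T * + 0 * + 0 + D * + 0
      vanish = solve-∀
    pair-size (+ suc m) = begin
      + (0 ℕ.+ S ℕ.+ 0 ℕ.+ (S ℕ.+ 0 ℕ.+ suc m)) ≡⟨ cong +_ (twice S (suc m)) ⟩
      + (2 ℕ.* S ℕ.+ suc m)                      ≡⟨ column-half′ s (suc m) ⟩
      T * M * M + (+ 2 * + s + + 1 - T) * M      ≡⟨ regroup (+ r) (+ s) M ⟩
      T * M * M + (+ s - + r) * M                ∎
      where
      S = arithSum t s (suc m)
      M = + suc m
      twice : ∀ S M → 0 ℕ.+ S ℕ.+ 0 ℕ.+ (S ℕ.+ 0 ℕ.+ M) ≡ 2 ℕ.* S ℕ.+ M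
      twice = NatSolver.solve-∀
      regroup : ∀ R S M → (R + S + + 1) * M * M + (+ 2 * S + + 1 - (R + S + + 1)) * M
                          ≡ (R + S + + 1) * M * M + (S - R) * M
      regroup = solve-∀
    pair-size -[1+ m ] = begin
      + (S ℕ.+ 0 ℕ.+ suc m ℕ.+ (0 ℕ.+ S ℕ.+ 0)) ≡⟨ cong +_ (twice S (suc m)) ⟩
      + (2 ℕ.* S ℕ.+ suc m)                      ≡⟨ column-half′ r (suc m) ⟩
      T * M * M + (+ 2 * + r + + 1 - T) * M      ≡⟨ regroup (+ r) (+ s) M ⟩
      T * - M * - M + (+ s - + r) * - M          ∎
      where
      S = arithSum t r (suc m)
      M = + suc m
      twice : ∀ S M → S ℕ.+ 0 ℕ.+ M ℕ.+ (0 ℕ.+ S ℕ.+ 0) ≡ 2 ℕ.* S ℕ.+ M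
      twice = NatSolver.solve-∀
      regroup : ∀ R S M → (R + S + + 1) * M * M + (+ 2 * R + + 1 - (R + S + + 1)) * M
                          ≡ (R + S + + 1) * - M * - M + (S - R) * - M
      regroup = solve-∀

  quad : ℤ → ℤ → ℤ
  quad k w = + 7 * w * w + + 2 * k * w

  sizeForm : ℤ → ℤ → ℤ → ℤ
  sizeForm x y z = quad (+ 1) x + quad (+ 2) y + quad (+ 3) z

  skew₇ : ℤ → ℤ → ℤ → Vec ℤ 7
  skew₇ x y z = - z ∷ - y ∷ - x ∷ + 0 ∷ x ∷ y ∷ z ∷ []

  size-skew₇ : ∀ x y z → + size (lam 7 (skew₇ x y z)) ≡ sizeForm x y z
  size-skew₇ x y z = begin
    + size (lam 7 (skew₇ x y z))
      ≡⟨ cong +_ (trans (size-lam 7 (skew₇ x y z))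
                        (pair-up (col 0 6 (- z)) (col 1 5 (- y)) (col 2 4 (- x)) (col 4 2 x) (col 5 1 y) (col 6 0 z))) ⟩
    + (X ℕ.+ Y ℕ.+ Z)  ≡⟨ trans (pos-+ (X ℕ.+ Y) Z) (cong (λ v → v + + Z) (pos-+ X Y)) ⟩
    + X + + Y + + Z    ≡⟨ cong₂ _+_ (cong₂ _+_ (pair-size 2 4 x) (pair-size 1 5 y)) (pair-size 0 6 z) ⟩
    sizeForm x y z            ∎
    where
    col : ℕ → ℕ → ℤ → ℕ
    col = columnSize 7
    X Y Z : ℕ
    X = col 2 4 (- x) ℕ.+ col 4 2 x
    Y = col 1 5 (- y) ℕ.+ col 5 1 y
    Z = col 0 6 (- z) ℕ.+ col 6 0 z
    pair-up : ∀ a b c d e f → a ℕ.+ (b ℕ.+ (c ℕ.+ (0 ℕ.+ (d ℕ.+ (e ℕ.+ (f ℕ.+ 0))))))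
                              ≡ c ℕ.+ d ℕ.+ (b ℕ.+ e) ℕ.+ (a ℕ.+ f)
    pair-up = NatSolver.solve-∀

  neg-flip : ∀ {a b} → b ≡ - a → a ≡ - b
  neg-flip {a} b≡-a = trans (sym (neg-involutive a)) (cong -_ (sym b≡-a))

  self-negating : ∀ {a} → a ≡ - a → a ≡ + 0
  self-negating {+ zero} _ = refl
  self-negating {+ suc n} ()
  self-negating { -[1+ n ]} ()

  skew⇒≡skew₇ : ∀ c → Skew c → c ≡ skew₇ (lookup c (# 4)) (lookup c (# 5)) (lookup c (# 6))
  skew⇒≡skew₇ (a₀ ∷ a₁ ∷ a₂ ∷ a₃ ∷ a₄ ∷ a₅ ∷ a₆ ∷ []) skew
    with refl ← neg-flip (skew (# 0))
    with refl ← neg-flip (skew (# 1))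
    with refl ← neg-flip (skew (# 2))
    with refl ← self-negating (skew (# 3))
    = refl

  skew₇-isSkew : ∀ x y z → Skew (skew₇ x y z)
  skew₇-isSkew x y z zero = sym (neg-involutive z)
  skew₇-isSkew x y z (suc zero) = sym (neg-involutive y)
  skew₇-isSkew x y z (suc (suc zero)) = sym (neg-involutive x)
  skew₇-isSkew x y z (suc (suc (suc zero))) = refl
  skew₇-isSkew x y z (suc (suc (suc (suc zero)))) = refl
  skew₇-isSkew x y z (suc (suc (suc (suc (suc zero))))) = refl
  skew₇-isSkew x y z (suc (suc (suc (suc (suc (suc zero)))))) = refl

  sumℤ-skew₇ : ∀ x y z → sumℤ (skew₇ x y z) ≡ + 0
  sumℤ-skew₇ = cancels
    where
    cancels : ∀ x y z → - z + (- y + (- x + (+ 0 + (x + (y + (z + + 0)))))) ≡ + 0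
    cancels = solve-∀

  SC⇒≡skew₇ : ∀ {n} c → SC 7 n c → ∃[ x ] ∃[ y ] ∃[ z ] c ≡ skew₇ x y z × sizeForm x y z ≡ + n
  SC⇒≡skew₇ {n} c (_ , size≡n , selfConjugate) = x , y , z , c≡skew₇ , (begin
    sizeForm x y z               ≡⟨ size-skew₇ x y z ⟨
    + size (lam 7 (skew₇ x y z)) ≡⟨ cong (λ v → + size (lam 7 v)) c≡skew₇ ⟨
    + size (lam 7 c)             ≡⟨ cong +_ size≡n ⟩
    + n                          ∎)
    where
    x = lookup c (# 4)
    y = lookup c (# 5)
    z = lookup c (# 6)
    c≡skew₇ : c ≡ skew₇ x y z
    c≡skew₇ = skew⇒≡skew₇ c (to (selfConjugate⇔Skew c) selfConjugate)

  skew₇∈SC : ∀ {n} x y z → sizeForm x y z ≡ + n → SC 7 n (skew₇ x y z)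
  skew₇∈SC x y z size≡n =
    sumℤ-skew₇ x y z ,
    +-injective (trans (size-skew₇ x y z) size≡n) ,
    from (selfConjugate⇔Skew (skew₇ x y z)) (skew₇-isSkew x y z)

  negOdd : ℤ → ℤ
  negOdd w = - (+ 2 * w + + 1)

  φ₂-skew₇ : ∀ x y z → φ₂ (skew₇ x y z) ≡ skew₇ (negOdd z) (+ 2 * x) (negOdd y)
  φ₂-skew₇ x y z rewrite neg-involutive (+ 2 * y + + 1) | neg-involutive (+ 2 * z + + 1) = refl

  negOdd-injective : ∀ {a b} → negOdd a ≡ negOdd b → a ≡ b
  negOdd-injective {a} {b} eq = *-cancelˡ-≡ (+ 2) a b (∙-cancelʳ (+ 1) _ _ (neg-injective eq))

  φ₂-skew₇-injective : ∀ {x y z x′ y′ z′} → φ₂ (skew₇ x y z) ≡ φ₂ (skew₇ x′ y′ z′) → skew₇ x y z ≡ skew₇ x′ y′ z′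
  φ₂-skew₇-injective {x} {y} {z} {x′} {y′} {z′} eq
    with refl ← *-cancelˡ-≡ (+ 2) x x′ (cong (λ v → lookup v (# 5)) eq)
    with refl ← negOdd-injective {z} {z′} (cong (λ v → lookup v (# 4)) eq)
    with refl ← negOdd-injective {y} {y′} (cong (λ v → lookup v (# 6)) eq)
    = refl

  sizeForm-φ₂ : ∀ x y z → sizeForm (negOdd z) (+ 2 * x) (negOdd y) ≡ + 4 * sizeForm x y z + + 6
  sizeForm-φ₂ = expanded
    where
    expanded : ∀ x y z →
      + 7 * - (+ 2 * z + + 1) * - (+ 2 * z + + 1) + + 2 * + 1 * - (+ 2 * z + + 1)
      + (+ 7 * (+ 2 * x) * (+ 2 * x) + + 2 * + 2 * (+ 2 * x))
      + (+ 7 * - (+ 2 * y + + 1) * - (+ 2 * y + + 1) + + 2 * + 3 * - (+ 2 * y + + 1))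
      ≡ + 4 * (+ 7 * x * x + + 2 * + 1 * x + (+ 7 * y * y + + 2 * + 2 * y) + (+ 7 * z * z + + 2 * + 3 * z)) + + 6
    expanded = solve-∀

  pos-4n+6 : ∀ n → + (4 ℕ.* n ℕ.+ 6) ≡ + 4 * + n + + 6
  pos-4n+6 n = trans (pos-+ (4 ℕ.* n) 6) (cong (λ v → v + + 6) (pos-* 4 n))

  sizeForm-φ₂⇔ : ∀ {n} x y z → sizeForm x y z ≡ + n ⇔ sizeForm (negOdd z) (+ 2 * x) (negOdd y) ≡ + (4 ℕ.* n ℕ.+ 6)
  sizeForm-φ₂⇔ {n} x y z = mk⇔
    (λ size≡n → trans (sizeForm-φ₂ x y z) (trans (cong (λ v → + 4 * v + + 6) size≡n) (sym (pos-4n+6 n))))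
    (λ size′≡ → *-cancelˡ-≡ (+ 4) _ _ (∙-cancelʳ (+ 6) _ _ (trans (sym (sizeForm-φ₂ x y z)) (trans size′≡ (pos-4n+6 n)))))

  data Parity : ℤ → Set where
    even : ∀ w → Parity (+ 2 * w)
    odd  : ∀ w → Parity (negOdd w)

  parity : ∀ x → Parity x
  parity x with x %ℕ 2 | n%ℕd<d x 2 | a≡a%ℕn+[a/ℕn]*n x 2
  ... | 0 | _ | x≡ = subst Parity (sym (trans x≡ (evenForm (x /ℕ 2)))) (even (x /ℕ 2))
    where
    evenForm : ∀ q → + 0 + q * + 2 ≡ + 2 * q
    evenForm = solve-∀
  ... | 1 | _ | x≡ = subst Parity (sym (trans x≡ (oddForm (x /ℕ 2)))) (odd (- (x /ℕ 2) - + 1))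
    where
    oddForm : ∀ q → + 1 + q * + 2 ≡ - (+ 2 * (- q - + 1) + + 1)
    oddForm = solve-∀
  ... | suc (suc _) | ℕ.s≤s (ℕ.s≤s ()) | _

  remainder : ∀ {w} → ℤ → Parity w → ℤ
  remainder k (even _) = + 0
  remainder k (odd _) = + 7 - + 2 * k

  quad-mod4 : ∀ {w} k (p : Parity w) → ∃[ q ] quad k w ≡ + 4 * q + remainder k p
  quad-mod4 k (even w) = + 7 * w * w + k * w , evenCase k w
    where
    evenCase : ∀ k w → + 7 * (+ 2 * w) * (+ 2 * w) + + 2 * k * (+ 2 * w) ≡ + 4 * (+ 7 * w * w + k * w) + + 0
    evenCase = solve-∀
  quad-mod4 k (odd w) = + 7 * w * w + (+ 7 - k) * w , oddCase k w
    where
    oddCase : ∀ k w → + 7 * - (+ 2 * w + + 1) * - (+ 2 * w + + 1) + + 2 * k * - (+ 2 * w + + 1)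
                      ≡ + 4 * (+ 7 * w * w + (+ 7 - k) * w) + (+ 7 - + 2 * k)
    oddCase = solve-∀

  sizeForm-mod4 : ∀ {x y z} (px : Parity x) (py : Parity y) (pz : Parity z) →
    ∃[ q ] sizeForm x y z ≡ + 4 * q + (remainder (+ 1) px + remainder (+ 2) py + remainder (+ 3) pz)
  sizeForm-mod4 px py pz
    with q₁ , e₁ ← quad-mod4 (+ 1) px
    with q₂ , e₂ ← quad-mod4 (+ 2) py
    with q₃ , e₃ ← quad-mod4 (+ 3) pz
    = q₁ + q₂ + q₃ , trans (cong₂ _+_ (cong₂ _+_ e₁ e₂) e₃) (collect q₁ q₂ q₃ _ _ _)
    where
    collect : ∀ q₁ q₂ q₃ r₁ r₂ r₃ → + 4 * q₁ + r₁ + (+ 4 * q₂ + r₂) + (+ 4 * q₃ + r₃)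
                                    ≡ + 4 * (q₁ + q₂ + q₃) + (r₁ + r₂ + r₃)
    collect = solve-∀

  4∣remainder+2 : ∀ {n q r} → + 4 * q + r ≡ + (4 ℕ.* n ℕ.+ 6) → + 4 ∣ r + + 2
  4∣remainder+2 {n} {q} {r} eq = ∣⇒∣ᵤ (divides (+ n + + 2 - q) (begin
    r + + 2                            ≡⟨ shift q r ⟩
    + 4 * q + r - + 4 * q + + 2        ≡⟨ cong (λ v → v - + 4 * q + + 2) (trans eq (pos-4n+6 n)) ⟩
    + 4 * + n + + 6 - + 4 * q + + 2    ≡⟨ collect (+ n) q ⟩
    (+ n + + 2 - q) * + 4              ∎))
    where
    shift : ∀ q r → r + + 2 ≡ + 4 * q + r - + 4 * q + + 2
    shift = solve-∀
    collect : ∀ n q → + 4 * n + + 6 - + 4 * q + + 2 ≡ (n + + 2 - q) * + 4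
    collect = solve-∀

  odd-even-odd : ∀ {x y z} (px : Parity x) (py : Parity y) (pz : Parity z) →
    + 4 ∣ remainder (+ 1) px + remainder (+ 2) py + remainder (+ 3) pz + + 2 →
    ∃[ a ] ∃[ b ] ∃[ c ] x ≡ negOdd a × y ≡ + 2 * b × z ≡ negOdd c
  odd-even-odd (odd a) (even b) (odd c) _ = a , b , c , refl , refl , refl
  odd-even-odd (even _) (even _) (even _) 4∣ with () ← n∣m⇒m%n≡0 _ 4 4∣
  odd-even-odd (even _) (even _) (odd _)  4∣ with () ← n∣m⇒m%n≡0 _ 4 4∣
  odd-even-odd (even _) (odd _)  (even _) 4∣ with () ← n∣m⇒m%n≡0 _ 4 4∣
  odd-even-odd (even _) (odd _)  (odd _)  4∣ with () ← n∣m⇒m%n≡0 _ 4 4∣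
  odd-even-odd (odd _)  (even _) (even _) 4∣ with () ← n∣m⇒m%n≡0 _ 4 4∣
  odd-even-odd (odd _)  (odd _)  (even _) 4∣ with () ← n∣m⇒m%n≡0 _ 4 4∣
  odd-even-odd (odd _)  (odd _)  (odd _)  4∣ with () ← n∣m⇒m%n≡0 _ 4 4∣

  sizeForm-parities : ∀ {n x y z} → sizeForm x y z ≡ + (4 ℕ.* n ℕ.+ 6) →
    ∃[ a ] ∃[ b ] ∃[ c ] x ≡ negOdd a × y ≡ + 2 * b × z ≡ negOdd c
  sizeForm-parities {n} {x} {y} {z} size≡ with q , size≡4q+r ← sizeForm-mod4 (parity x) (parity y) (parity z) =
    odd-even-odd (parity x) (parity y) (parity z) (4∣remainder+2 {n} {q} (trans (sym size≡4q+r) size≡))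

  φ₂-skew₇∈SC : ∀ {n} x y z → sizeForm x y z ≡ + n → SC 7 (4 ℕ.* n ℕ.+ 6) (φ₂ (skew₇ x y z))
  φ₂-skew₇∈SC {n} x y z size≡n = subst (SC 7 (4 ℕ.* n ℕ.+ 6)) (sym (φ₂-skew₇ x y z))
    (skew₇∈SC (negOdd z) (+ 2 * x) (negOdd y) (to (sizeForm-φ₂⇔ x y z) size≡n))

open SevenCores
open import Data.Nat using (_+_; _*_)

theorem5p12 : (n : ℕ) →
    ((c : Vec ℤ 7) → SC 7 n c → SC 7 (4 * n + 6) (φ₂ c))
    × ((c c′ : Vec ℤ 7) → SC 7 n c → SC 7 n c′ → φ₂ c ≡ φ₂ c′ → c ≡ c′)
    × ((d : Vec ℤ 7) → SC 7 (4 * n + 6) d → ∃[ c ] (SC 7 n c × φ₂ c ≡ d))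
theorem5p12 n = maps-into , injective , surjective
  where
  maps-into : (c : Vec ℤ 7) → SC 7 n c → SC 7 (4 * n + 6) (φ₂ c)
  maps-into c c∈ = case SC⇒≡skew₇ c c∈ of λ where
    (x , y , z , refl , size≡n) → φ₂-skew₇∈SC x y z size≡n

  injective : (c c′ : Vec ℤ 7) → SC 7 n c → SC 7 n c′ → φ₂ c ≡ φ₂ c′ → c ≡ c′
  injective c c′ c∈ c′∈ = case SC⇒≡skew₇ c c∈ , SC⇒≡skew₇ c′ c′∈ of λ where
    ((x , y , z , refl , _) , (x′ , y′ , z′ , refl , _)) → φ₂-skew₇-injective {x} {y} {z} {x′} {y′} {z′}

  surjective : (d : Vec ℤ 7) → SC 7 (4 * n + 6) d → ∃[ c ] (SC 7 n c × φ₂ c ≡ d)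
  surjective d d∈ = case SC⇒≡skew₇ d d∈ of λ where
    (x′ , y′ , z′ , refl , size≡) → case sizeForm-parities {n} {x′} {y′} {z′} size≡ of λ where
      (a , b , c , refl , refl , refl) → skew₇ b c a , skew₇∈SC b c a (from (sizeForm-φ₂⇔ b c a) size≡) , φ₂-skew₇ b c a
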